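{- Let $\mathcal{G}=(V,\{C_1,\dots,C_\tau\},R)$ be a multi-layer graph such that the simple graph $(V,R)$ is a tree and at least one of the simple graphs $(V,C_i)$ is connected. Then the multi-layer cop number of $\mathcal{G}$ is at most $2$.
   Context: A multi-layer graph with designated layers is $(V,\{C_1,\dots,C_\tau\},R)$ with finite vertex set $V$, cop layers $C_i\subseteq\binom V2$ and robber layer $R\subseteq\binom V2$. Game with an allocation $(k_1,\dots,k_\tau)$ of nonnegative integers: $k_i$ cops are assigned to $C_i$; cops are placed on vertices first, then the robber; turns alternate starting with the cops; on the cops' turn each cop stays or moves along one edge of its own layer; on the robber's turn it stays or moves along one edge of $R$; the cops win if some cop ever occupies the robber's vertex, the robber wins if it evades forever; perfect information. The multi-layer cop number is the least $k$ such that some allocation with $\sum_i k_i=k$ gives the cop player a winning strategy. -}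

module Defs where

open import Level using (0ℓ)
open import Data.Nat using (ℕ; zero; suc; _+_; _≤_)
open import Data.Fin using (Fin; zero; suc)
open import Data.List using (List; []; _∷_; _∷ʳ_; length)
open import Data.List.Relation.Unary.Linked using (Linked)
open import Data.List.Relation.Unary.Unique.Propositional using (Unique)
open import Data.Product using (Σ; ∃; _×_; _,_)
open import Data.Sum using (_⊎_)
open import Relation.Nullary using (¬_)
open import Relation.Binary using (Rel; Symmetric; Irreflexive)
open import Relation.Binary.PropositionalEquality using (_≡_)
open import Relation.Binary.Construct.Closure.ReflexiveTransitive using (Star)

-- V is the finite vertex set Fin n; each layer is a set of 2-element subsets
-- of V, represented as a symmetric irreflexive edge relation on V.
record MultiLayerGraph : Set₁ where
  field
    n      : ℕ
    τ      : ℕ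
    C      : Fin τ → Rel (Fin n) 0ℓ
    R      : Rel (Fin n) 0ℓ
    C-sym  : (i : Fin τ) → Symmetric (C i)
    C-irr  : (i : Fin τ) → Irreflexive _≡_ (C i)
    R-sym  : Symmetric R
    R-irr  : Irreflexive _≡_ R

Connected : {n : ℕ} → Rel (Fin n) 0ℓ → Set
Connected {n} E = (u v : Fin n) → Star E u v

HasCycle : {n : ℕ} → Rel (Fin n) 0ℓ → Set
HasCycle {n} E =
  Σ (Fin n) λ v → Σ (List (Fin n)) λ ws →
    (2 ≤ length ws) × Unique (v ∷ ws) × Linked E ((v ∷ ws) ∷ʳ v)

IsTree : {n : ℕ} → Rel (Fin n) 0ℓ → Set
IsTree E = Connected E × ¬ HasCycle E

total : (τ : ℕ) → (Fin τ → ℕ) → ℕ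
total zero    k = 0
total (suc τ) k = k zero + total τ (λ i → k (suc i))

module Game (G : MultiLayerGraph) (k : Fin (MultiLayerGraph.τ G) → ℕ) where
  open MultiLayerGraph G

  CopPos : Set
  CopPos = (i : Fin τ) → Fin (k i) → Fin n

  Caught : CopPos → Fin n → Set
  Caught p r = Σ (Fin τ) λ i → Σ (Fin (k i)) λ j → p i j ≡ r

  CopMove : CopPos → CopPos → Set
  CopMove p p' = (i : Fin τ) (j : Fin (k i)) → (p i j ≡ p' i j) ⊎ C i (p i j) (p' i j)

  RobMove : Fin n → Fin n → Set
  RobMove r r' = (r ≡ r') ⊎ R r r'

  -- CopsWin p r : a (well-founded) winning strategy for the cops from the
  -- position where cops are at p, the robber at r, and it is the cops' turn.
  -- Since all choices are finite, the cops win (capture in finite time against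
  -- every robber play) iff such a strategy tree exists.
  data CopsWin : CopPos → Fin n → Set where
    caught : ∀ {p r} → Caught p r → CopsWin p r
    move   : ∀ {p r} (p' : CopPos) → CopMove p p' →
             (Caught p' r ⊎ ((r' : Fin n) → RobMove r r' → CopsWin p' r')) →
             CopsWin p r

  -- Cops are placed first, then the robber, then the cops move first.
  CopsHaveWinningStrategy : Set
  CopsHaveWinningStrategy = Σ CopPos λ p → (r : Fin n) → CopsWin p r

CopNumber≤ : MultiLayerGraph → ℕ → Set
CopNumber≤ G m =
  Σ (Fin (MultiLayerGraph.τ G) → ℕ) λ k →
    (total (MultiLayerGraph.τ G) k ≤ m) × Game.CopsHaveWinningStrategy G k

-- Both cops live on a connected cop layer. One cop guards a vertex g of the
-- tree R; since R has no cycles, the robber cannot leave the branch of R at g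
-- that it occupies without stepping onto g. The other cop walks through its
-- connected layer to the neighbour u of g on that branch; once it arrives the
-- cops swap roles, and the branch the robber is confined to has moved one step
-- further from the starting vertex. Distances in a tree are bounded by the
-- number of vertices, so after finitely many phases the robber is caught.
module Submission where

open import Defs
open import Level using (0ℓ)
open import Data.Bool using (if_then_else_)
open import Data.Empty using (⊥-elim)
open import Data.Fin using (Fin; zero; suc)
open import Data.Fin.Properties using (_≟_; injective⇒≤; ¬Fin0)
open import Data.List using (List; []; _∷_; _++_; _∷ʳ_; [_]; length; lookup)
open import Data.List.Membership.Propositional using (_∈_; _∉_)
open import Data.List.Membership.Propositional.Properties using (∈-∃++; ∈-++⁺ʳ; ∈-lookup)
import Data.List.Membership.DecPropositional as DecMembership
open import Data.List.Relation.Binary.Pointwise using ([]; _∷_)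
open import Data.List.Relation.Binary.Suffix.Heterogeneous using (Suffix; here; there)
open import Data.List.Relation.Binary.Suffix.Heterogeneous.Properties using (length-mono)
import Data.List.Relation.Unary.All as All
open All using ([]; _∷_)
open import Data.List.Relation.Unary.All.Properties using (¬Any⇒All¬; ++⁻ˡ)
open import Data.List.Relation.Unary.AllPairs using ([]; _∷_)
open import Data.List.Relation.Unary.Any using (here; there)
open import Data.List.Relation.Unary.Linked using (Linked; []; [-]; _∷_)
open import Data.List.Relation.Unary.Unique.Propositional using (Unique)
open import Data.Nat using (ℕ; zero; suc; _+_; _≤_; z≤n; s≤s)
open import Data.Nat.Properties using (≤-trans; n≮n; +-suc; +-identityʳ; m≤m+n)
open import Data.Product using (Σ; ∃; _,_; proj₁; proj₂; map₂)
open import Data.Sum using (_⊎_; inj₁; inj₂)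
open import Data.Vec.Functional using (Vector)
open import Function.Definitions using (Injective)
open import Relation.Binary using (Rel; Symmetric; Irreflexive; DecidableEquality)
open import Relation.Binary.Construct.Closure.ReflexiveTransitive using (Star; ε; _◅_)
open import Relation.Binary.PropositionalEquality using (_≡_; _≢_; refl; sym; trans; cong; subst; ≢-sym)
open import Relation.Nullary using (¬_; Dec; yes; no; does)

module _ {A : Set} where

  Linked-prefix : ∀ {R : Rel A 0ℓ} xs {y ys} → Linked R (xs ++ y ∷ ys) → Linked R (xs ∷ʳ y)
  Linked-prefix []               _         = [-]
  Linked-prefix (x ∷ [])         (e ∷ _)   = e ∷ [-]
  Linked-prefix (x ∷ x′ ∷ xs)    (e ∷ lk)  = e ∷ Linked-prefix (x′ ∷ xs) lk

  Unique[xs++y∷ys]⇒Unique[y∷xs] : ∀ xs {y : A} {ys} → Unique (xs ++ y ∷ ys) → Unique (y ∷ xs)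
  Unique[xs++y∷ys]⇒Unique[y∷xs] []       (_ ∷ _)   = [] ∷ []
  Unique[xs++y∷ys]⇒Unique[y∷xs] (x ∷ xs) (x∉ ∷ un)
    with y∉xs ∷ unxs ← Unique[xs++y∷ys]⇒Unique[y∷xs] xs un =
    (y≢x ∷ y∉xs) ∷ (++⁻ˡ xs x∉ ∷ unxs)
    where y≢x = ≢-sym (All.lookup x∉ (∈-++⁺ʳ xs (here refl)))

  Unique⇒lookup-injective : ∀ {xs : List A} → Unique xs → Injective _≡_ _≡_ (lookup xs)
  Unique⇒lookup-injective                 (_  ∷ _)  {zero}  {zero}  _  = refl
  Unique⇒lookup-injective {xs = _ ∷ xs}   (x∉ ∷ _)  {zero}  {suc j} eq =
    ⊥-elim (All.lookup x∉ (∈-lookup {xs = xs} j) eq)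
  Unique⇒lookup-injective {xs = _ ∷ xs}   (x∉ ∷ _)  {suc i} {zero}  eq =
    ⊥-elim (All.lookup x∉ (∈-lookup {xs = xs} i) (sym eq))
  Unique⇒lookup-injective                 (_  ∷ un) {suc i} {suc j} eq =
    cong suc (Unique⇒lookup-injective un eq)

  suffix-extend : ∀ {x y : A} {ys zs} → Suffix _≡_ (y ∷ ys) zs →
                  ∃ λ z → Suffix _≡_ (z ∷ y ∷ ys) (x ∷ zs)
  suffix-extend {x = x} (here p)  = x , here (refl ∷ p)
  suffix-extend         (there s) = map₂ there (suffix-extend s)

Unique⇒length≤ : ∀ {m} {xs : List (Fin m)} → Unique xs → length xs ≤ m
Unique⇒length≤ un = injective⇒≤ (Unique⇒lookup-injective un)

record SimplePath {A : Set} (R : Rel A 0ℓ) (x : A) (trail : List A) : Set where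
  constructor simplePath
  field
    rest   : List A
    linked : Linked R (x ∷ rest)
    unique : Unique (x ∷ rest)
    ends   : Suffix _≡_ trail (x ∷ rest)

module _ {A : Set} {R : Rel A 0ℓ} where

  SimplePath-extend : ∀ {x y ys} → SimplePath R x (y ∷ ys) → x ≢ y →
                      ∃ λ z → SimplePath R x (z ∷ y ∷ ys)
  SimplePath-extend (simplePath _ _ _ (here (y≡x ∷ _))) x≢y = ⊥-elim (x≢y (sym y≡x))
  SimplePath-extend (simplePath rest lk un (there s))   _   =
    map₂ (simplePath rest lk un) (suffix-extend s)

  SimplePath-from : ∀ {x y xs} → x ∈ xs → Linked R xs → Unique xs →
                    Suffix _≡_ [ y ] xs → SimplePath R x [ y ]
  SimplePath-from (here refl) lk un ends = simplePath _ lk un ends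
  SimplePath-from {xs = _ ∷ _ ∷ _} (there x∈) (_ ∷ lk) (_ ∷ un) (there ends) =
    SimplePath-from x∈ lk un ends
  SimplePath-from {xs = _ ∷ _ ∷ _} (there _) _ _ (here (_ ∷ ()))

  module _ (_≟ᴬ_ : DecidableEquality A) where
    open DecMembership _≟ᴬ_ using (_∈?_)

    -- Loop erasure: when x recurs on the erased path of the tail, cut the loop.
    Star⇒SimplePath : ∀ {x y} → Star R x y → SimplePath R x [ y ]
    Star⇒SimplePath ε = simplePath [] [-] ([] ∷ []) (here (refl ∷ []))
    Star⇒SimplePath {x} (e ◅ walk)
      with simplePath rest lk un ends ← Star⇒SimplePath walk
      with x ∈? (_ ∷ rest)
    ... | yes x∈ = SimplePath-from x∈ lk un ends
    ... | no  x∉ = simplePath (_ ∷ rest) (e ∷ lk) (¬Any⇒All¬ _ x∉ ∷ un) (there ends)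

SimplePath-length≤ : ∀ {m} {R : Rel (Fin m) 0ℓ} {x trail} → SimplePath R x trail → length trail ≤ m
SimplePath-length≤ (simplePath _ _ un ends) = ≤-trans (length-mono ends) (Unique⇒length≤ un)

module Forest {m} {R : Rel (Fin m) 0ℓ} (R-sym : Symmetric R) (R-irr : Irreflexive _≡_ R)
              (acyclic : ¬ HasCycle R) where
  open DecMembership (_≟_ {m}) using (_∈?_)

  neighbour-off-path-or-next : ∀ {r r′ xs} → Linked R (r ∷ xs) → Unique (r ∷ xs) → R r r′ →
                               r′ ∉ r ∷ xs ⊎ ∃ λ ys → xs ≡ r′ ∷ ys
  neighbour-off-path-or-next {r} {r′} {xs} lk un e with r′ ∈? r ∷ xs
  ... | no  r′∉         = inj₁ r′∉
  ... | yes (here refl) = ⊥-elim (R-irr refl e)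
  ... | yes (there r′∈) with ∈-∃++ r′∈
  ...   | []     , ys , refl = inj₂ (ys , refl)
  ...   | a ∷ as , ys , refl = ⊥-elim (acyclic cycle)
    where
    -- The edge r r′ closes the path segment from r to r′.
    cycle : HasCycle R
    cycle = r′ , r ∷ a ∷ as , s≤s (s≤s z≤n)
          , Unique[xs++y∷ys]⇒Unique[y∷xs] (r ∷ a ∷ as) un
          , R-sym e ∷ Linked-prefix (r ∷ a ∷ as) lk

  SimplePath-follow : ∀ {r r′ t g pre} → SimplePath R r (t ∷ g ∷ pre) → r ≡ r′ ⊎ R r r′ → r′ ≢ g →
                      SimplePath R r′ (t ∷ g ∷ pre)
  SimplePath-follow path (inj₁ refl) _ = path
  SimplePath-follow {r′ = r′} {t} {g} {pre} (simplePath rest lk un ends) (inj₂ e) r′≢g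
    with neighbour-off-path-or-next lk un e
  ... | inj₁ r′∉ = simplePath (_ ∷ rest) (R-sym e ∷ lk) (¬Any⇒All¬ _ r′∉ ∷ un) (there ends)
  ... | inj₂ (ys , refl) with _ ∷ lk′ ← lk with _ ∷ un′ ← un =
    simplePath ys lk′ un′ (retreat ends)
    where
    retreat : Suffix _≡_ (t ∷ g ∷ pre) (_ ∷ r′ ∷ ys) → Suffix _≡_ (t ∷ g ∷ pre) (r′ ∷ ys)
    retreat (here (_ ∷ g≡r′ ∷ _)) = ⊥-elim (r′≢g (sym g≡r′))
    retreat (there s)             = s

single : ∀ {τ} → Fin τ → ℕ → Fin τ → ℕ
single ℓ m i = if does (i ≟ ℓ) then m else 0

total-zero : ∀ τ → total τ (λ _ → 0) ≡ 0
total-zero zero    = refl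
total-zero (suc τ) = total-zero τ

total-single : ∀ {τ} (ℓ : Fin τ) m → total τ (single ℓ m) ≡ m
total-single {suc τ} zero    m = trans (cong (m +_) (total-zero τ)) (+-identityʳ m)
total-single {suc τ} (suc ℓ) m = total-single ℓ m

squad : ∀ {A P : Set} (d : Dec P) → Vector A 2 → Fin (if does d then 2 else 0) → A
squad (yes _) cops = cops
squad (no _)  _    ()

squad-member : ∀ {A P : Set} (d : Dec P) → P → (cops : Vector A 2) (j : Fin 2) →
               Σ (Fin (if does d then 2 else 0)) λ j′ → squad d cops j′ ≡ cops j
squad-member (yes _) _ _ j = j , refl
squad-member (no ¬p) p _ _ = ⊥-elim (¬p p)

empty⇒CopNumber≤ : ∀ (G : MultiLayerGraph) m → ¬ Fin (MultiLayerGraph.n G) → CopNumber≤ G m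
empty⇒CopNumber≤ G m noVertex =
  (λ _ → 0) , subst (_≤ m) (sym (total-zero (MultiLayerGraph.τ G))) z≤n
  , (λ _ ()) , λ r → ⊥-elim (noVertex r)

module TwoCops (G : MultiLayerGraph) (ℓ : Fin (MultiLayerGraph.τ G)) where
  open MultiLayerGraph G
  open Game G (single ℓ 2)

  deploy : Vector (Fin n) 2 → CopPos
  deploy cops i = squad (i ≟ ℓ) cops

  deploy-catches : ∀ cops j → Caught (deploy cops) (cops j)
  deploy-catches cops j = ℓ , squad-member (ℓ ≟ ℓ) refl cops j

  CopStep : Fin n → Fin n → Set
  CopStep x y = x ≡ y ⊎ C ℓ x y

  deploy-move : ∀ {cops cops′} → (∀ j → CopStep (cops j) (cops′ j)) → CopMove (deploy cops) (deploy cops′)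
  deploy-move {cops} {cops′} steps i = squad-move (i ≟ ℓ)
    where
    squad-move : (d : Dec (i ≡ ℓ)) (j : Fin (if does d then 2 else 0)) →
                 squad d cops j ≡ squad d cops′ j ⊎ C i (squad d cops j) (squad d cops′ j)
    squad-move (yes refl) = steps
    squad-move (no _)     ()

  record Roles : Set where
    field
      place          : (guard walker : Fin n) → CopPos
      guard-catches  : ∀ {g b} → Caught (place g b) g
      walker-catches : ∀ {g b} → Caught (place g b) b
      step           : ∀ {g g′ b b′} → CopStep g g′ → CopStep b b′ → CopMove (place g b) (place g′ b′)
  open Roles

  roles : Roles
  roles = record
    { place          = λ g b → deploy λ { zero → g ; (suc _) → b }
    ; guard-catches  = deploy-catches _ zero
    ; walker-catches = deploy-catches _ (suc zero)
    ; step           = λ sg sb → deploy-move λ { zero → sg ; (suc zero) → sb }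
    }

  swapped : Roles → Roles
  swapped P = record
    { place          = λ g b → place P b g
    ; guard-catches  = walker-catches P
    ; walker-catches = guard-catches P
    ; step           = λ sg sb → step P sb sg
    }

  module Strategy (tree : IsTree R) (conn : Connected (C ℓ)) where
    open Forest R-sym R-irr (proj₂ tree)

    -- A robber with simple path SimplePath R r (u ∷ g ∷ pre) is confined to the
    -- branch at the guard g through u: leaving it means stepping onto g.
    walk : ∀ (P : Roles) {g b u pre} → Star (C ℓ) b u →
           (∀ {r} → SimplePath R r (u ∷ g ∷ pre) → CopsWin (place P g u) r) →
           ∀ {r} → SimplePath R r (u ∷ g ∷ pre) → CopsWin (place P g b) r
    walk P ε                          onArrival path = onArrival path
    walk P {g} (_◅_ {j = b′} e route) onArrival {r} path =
      move (place P g b′) (step P (inj₁ refl) (inj₂ e)) (inj₂ respond)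
      where
      respond : ∀ r′ → RobMove r r′ → CopsWin (place P g b′) r′
      respond r′ rm with r′ ≟ g
      ... | yes refl = caught (guard-catches P)
      ... | no  r′≢g = walk P route onArrival (SimplePath-follow path rm r′≢g)

    -- The fuel bounds the number of remaining phases: each phase lengthens
    -- the trail, whose length never exceeds n.
    arrive : ∀ fuel (P : Roles) {g u pre r} → n ≤ fuel + length (u ∷ g ∷ pre) →
             SimplePath R r (u ∷ g ∷ pre) → CopsWin (place P g u) r
    arrive fuel P {g} {u} {pre} {r} bound path with r ≟ u
    ... | yes refl = caught (walker-catches P)
    ... | no  r≢u  with u′ , path′ ← SimplePath-extend path r≢u with fuel
    ...   | zero       = ⊥-elim (n≮n _ (≤-trans (SimplePath-length≤ path′) bound))
    ...   | suc fuel′  =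
      walk (swapped P) (conn g u′) (arrive fuel′ (swapped P) bound′) path′
      where
      bound′ : n ≤ fuel′ + length (u′ ∷ u ∷ g ∷ pre)
      bound′ = subst (n ≤_) (sym (+-suc fuel′ (length (u ∷ g ∷ pre)))) bound

    wins-from : (g₀ : Fin n) → ∀ r → CopsWin (place roles g₀ g₀) r
    wins-from g₀ r with r ≟ g₀
    ... | yes refl = caught (guard-catches roles)
    ... | no  r≢g₀ with u , path ← SimplePath-extend (Star⇒SimplePath _≟_ (proj₁ tree r g₀)) r≢g₀ =
      walk roles (conn g₀ u) (arrive n roles (m≤m+n n 2)) path

    copNumber≤2 : Fin n → CopNumber≤ G 2
    copNumber≤2 g₀ =
      single ℓ 2 , subst (_≤ 2) (sym (total-single ℓ 2)) (s≤s (s≤s z≤n))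
      , place roles g₀ g₀ , wins-from g₀

vertex? : ∀ m → Fin m ⊎ ¬ Fin m
vertex? zero    = inj₂ ¬Fin0
vertex? (suc m) = inj₁ zero

corollary4p5 : (G : MultiLayerGraph) →
    IsTree (MultiLayerGraph.R G) →
    Σ (Fin (MultiLayerGraph.τ G)) (λ i → Connected (MultiLayerGraph.C G i)) →
    CopNumber≤ G 2
corollary4p5 G tree (ℓ , conn) with vertex? (MultiLayerGraph.n G)
... | inj₁ g₀       = TwoCops.Strategy.copNumber≤2 G ℓ tree conn g₀
... | inj₂ noVertex = empty⇒CopNumber≤ G 2 noVertex
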